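{- The operad $\mathbb{K}\mathbf{G}$ is not free (it is not isomorphic to a free operad on any species), and it is not generated by any finite family of elements.
   Context: A graph on a finite set $V$ is a set of unordered pairs $\{u,v\}$ with $u\neq v$ in $V$. $\mathbf{G}[V]$ is the set of graphs on $V$ and $\mathbb{K}\mathbf{G}[V]$ (over a field $\mathbb{K}$ of characteristic zero) has basis $\mathbf{G}[V]$, with relabelling along bijections. $\mathbb{K}\mathbf{G}$ is an operad in the species formalism (spaces indexed by nonempty finite sets; equivariant partial compositions $\circ_\ast:\mathbb{K}\mathbf{G}[V_1]\otimes\mathbb{K}\mathbf{G}[V_2]\to\mathbb{K}\mathbf{G}[(V_1\setminus\{\ast\})\sqcup V_2]$ for disjoint $V_1\ni\ast$ and $V_2$; unit the one-vertex graph) with partial composition $g_1\circ_\ast g_2=\sum_{f:N_\ast\to V_2}\big((g_1\setminus\{\ast\})\cup g_2\cup\bigcup_{v\in N_\ast}\{\{v,f(v)\}\}\big)$, where $N_\ast$ is the set of neighbours of $\ast$ in $g_1$ and $g_1\setminus\{\ast\}$ is $g_1$ with $\ast$ and its incident edges removed. The free operad on a species $H$ is spanned by trees whose leaves are labelled by $V$ and whose internal nodes with $k$ children are decorated by elements of $H$, composition being grafting. A family generates an operad if the smallest suboperad containing it is the whole operad. -}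

module Defs where

open import Level using (0ℓ)
open import Data.Nat using (ℕ; zero; suc) renaming (_+_ to _+ℕ_)
open import Data.Nat.Properties using (+-suc)
open import Data.Fin using (Fin) renaming (zero to fzero; suc to fsuc)
open import Data.Fin.Properties using (+↔⊎; 1↔⊤) renaming (_≟_ to _≟F_)
open import Data.Sum using (_⊎_; inj₁; inj₂)
open import Data.Sum.Function.Propositional using (_⊎-↔_)
open import Data.Maybe using (Maybe; just; nothing)
import Data.Maybe as Maybe
import Data.List as L
open import Data.Unit using (⊤; tt)
open import Data.Empty using (⊥)
open import Data.Product using (Σ; Σ-syntax; _×_; _,_; proj₁; proj₂)
open import Data.Bool using (Bool; true; false; _∧_; _∨_; not; if_then_else_)
open import Data.List using (List; []; _∷_; [_]; _++_; concatMap; foldr; length; lookup; allFin)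
open import Function using (_∘_; id)
open import Function.Bundles using (_↔_; Inverse; mk↔ₛ′)
open import Function.Properties.Inverse using (↔-trans; ↔-sym; ↔-refl)
open import Relation.Binary.PropositionalEquality using (_≡_; refl; cong; subst)
open import Relation.Nullary using (¬_)
open import Relation.Nullary.Decidable using (isYes)
open import Algebra.Bundles using (CommutativeRing)
open import Algebra.Module.Structures using (IsModule)

natK : (R : CommutativeRing 0ℓ 0ℓ) → ℕ → CommutativeRing.Carrier R
natK R zero    = CommutativeRing.0# R
natK R (suc n) = CommutativeRing._+_ R (CommutativeRing.1# R) (natK R n)

record CharZeroField : Set₁ where
  field
    cring : CommutativeRing 0ℓ 0ℓ
  open CommutativeRing cring
  field
    1≉0      : ¬ (1# ≈ 0#)
    inverse  : ∀ x → ¬ (x ≈ 0#) → Σ Carrier λ y → x * y ≈ 1#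
    charZero : ∀ n → ¬ (natK cring (suc n) ≈ 0#)

record FinSet : Set₁ where
  field
    Carrier : Set
    size    : ℕ
    enc     : Carrier ↔ Fin size
open FinSet public

record FinSet⁺ : Set₁ where
  field
    Carrier⁺ : Set
    pred     : ℕ
    enc⁺     : Carrier⁺ ↔ Fin (suc pred)
open FinSet⁺ public

maybe-↔ : {A B : Set} → A ↔ B → Maybe A ↔ Maybe B
maybe-↔ σ = mk↔ₛ′ (Maybe.map (Inverse.to σ)) (Maybe.map (Inverse.from σ))
  (λ { nothing → refl ; (just b) → cong just (Inverse.strictlyInverseˡ σ b) })
  (λ { nothing → refl ; (just a) → cong just (Inverse.strictlyInverseʳ σ a) })

maybeFin : (n : ℕ) → Maybe (Fin n) ↔ Fin (suc n)
maybeFin n = mk↔ₛ′ (λ { nothing → fzero ; (just i) → fsuc i })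
  (λ { fzero → nothing ; (fsuc i) → just i })
  (λ { fzero → refl ; (fsuc i) → refl })
  (λ { nothing → refl ; (just i) → refl })

∅ : FinSet
∅ = record { Carrier = ⊥ ; size = 0 ; enc = mk↔ₛ′ (λ ()) (λ ()) (λ ()) (λ ()) }

-- A ↦ A ⊔ {∗}  (the new point ∗ is 'nothing')
Maybe⁺ : FinSet → FinSet⁺
Maybe⁺ A = record { Carrier⁺ = Maybe (Carrier A) ; pred = size A
                  ; enc⁺ = ↔-trans (maybe-↔ (enc A)) (maybeFin (size A)) }

Maybeᶠ : FinSet → FinSet
Maybeᶠ A = record { Carrier = Maybe (Carrier A) ; size = suc (size A)
                  ; enc = ↔-trans (maybe-↔ (enc A)) (maybeFin (size A)) }

_⊎ᶠ_ : FinSet → FinSet → FinSet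
A ⊎ᶠ B = record { Carrier = Carrier A ⊎ Carrier B ; size = size A +ℕ size B
                ; enc = ↔-trans (enc A ⊎-↔ enc B) (↔-sym +↔⊎) }

_⊎⁺_ : FinSet → FinSet⁺ → FinSet⁺
A ⊎⁺ B = record { Carrier⁺ = Carrier A ⊎ Carrier⁺ B ; pred = size A +ℕ pred B
                ; enc⁺ = subst (λ m → (Carrier A ⊎ Carrier⁺ B) ↔ Fin m) (+-suc (size A) (pred B))
                               (↔-trans (enc A ⊎-↔ enc⁺ B) (↔-sym +↔⊎)) }

⊥⊎↔ : {B : Set} → B ↔ (⊥ ⊎ B)
⊥⊎↔ = mk↔ₛ′ inj₂ (λ { (inj₁ ()) ; (inj₂ b) → b }) (λ { (inj₁ ()) ; (inj₂ b) → refl }) (λ _ → refl)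

unitʳ↔ : {A : Set} → Maybe A ↔ (A ⊎ Maybe ⊥)
unitʳ↔ = mk↔ₛ′ (λ { nothing → inj₂ nothing ; (just a) → inj₁ a })
               (λ { (inj₁ a) → just a ; (inj₂ nothing) → nothing })
               (λ { (inj₁ a) → refl ; (inj₂ nothing) → refl })
               (λ { nothing → refl ; (just a) → refl })

seq↔ : {A B : Set} → (A ⊎ Maybe B) ↔ Maybe (A ⊎ B)
seq↔ = mk↔ₛ′ (λ { (inj₁ a) → just (inj₁ a) ; (inj₂ nothing) → nothing ; (inj₂ (just b)) → just (inj₂ b) })
             (λ { nothing → inj₂ nothing ; (just (inj₁ a)) → inj₁ a ; (just (inj₂ b)) → inj₂ (just b) })
             (λ { nothing → refl ; (just (inj₁ a)) → refl ; (just (inj₂ b)) → refl })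
             (λ { (inj₁ a) → refl ; (inj₂ nothing) → refl ; (inj₂ (just b)) → refl })

par↔ : {A B : Set} → (Maybe A ⊎ B) ↔ Maybe (A ⊎ B)
par↔ = mk↔ₛ′ (λ { (inj₁ nothing) → nothing ; (inj₁ (just a)) → just (inj₁ a) ; (inj₂ b) → just (inj₂ b) })
             (λ { nothing → inj₁ nothing ; (just (inj₁ a)) → inj₁ (just a) ; (just (inj₂ b)) → inj₂ b })
             (λ { nothing → refl ; (just (inj₁ a)) → refl ; (just (inj₂ b)) → refl })
             (λ { (inj₁ nothing) → refl ; (inj₁ (just a)) → refl ; (inj₂ b) → refl })

assoc↔ : {A B C : Set} → ((A ⊎ B) ⊎ C) ↔ (A ⊎ (B ⊎ C))
assoc↔ = mk↔ₛ′ (λ { (inj₁ (inj₁ a)) → inj₁ a ; (inj₁ (inj₂ b)) → inj₂ (inj₁ b) ; (inj₂ c) → inj₂ (inj₂ c) })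
               (λ { (inj₁ a) → inj₁ (inj₁ a) ; (inj₂ (inj₁ b)) → inj₁ (inj₂ b) ; (inj₂ (inj₂ c)) → inj₂ c })
               (λ { (inj₁ a) → refl ; (inj₂ (inj₁ b)) → refl ; (inj₂ (inj₂ c)) → refl })
               (λ { (inj₁ (inj₁ a)) → refl ; (inj₁ (inj₂ b)) → refl ; (inj₂ c) → refl })

swap↔ : {A B C : Set} → ((A ⊎ B) ⊎ C) ↔ ((A ⊎ C) ⊎ B)
swap↔ = mk↔ₛ′ (λ { (inj₁ (inj₁ a)) → inj₁ (inj₁ a) ; (inj₁ (inj₂ b)) → inj₂ b ; (inj₂ c) → inj₁ (inj₂ c) })
              (λ { (inj₁ (inj₁ a)) → inj₁ (inj₁ a) ; (inj₁ (inj₂ c)) → inj₂ c ; (inj₂ b) → inj₁ (inj₂ b) })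
              (λ { (inj₁ (inj₁ a)) → refl ; (inj₁ (inj₂ c)) → refl ; (inj₂ b) → refl })
              (λ { (inj₁ (inj₁ a)) → refl ; (inj₁ (inj₂ b)) → refl ; (inj₂ c) → refl })

exch↔ : {A : Set} → Maybe (Maybe A) ↔ Maybe (Maybe A)
exch↔ = mk↔ₛ′ f f inv inv
  where
  f : {A : Set} → Maybe (Maybe A) → Maybe (Maybe A)
  f nothing = just nothing
  f (just nothing) = nothing
  f (just (just a)) = just (just a)
  inv : {A : Set} → ∀ x → f {A} (f x) ≡ x
  inv nothing = refl
  inv (just nothing) = refl
  inv (just (just a)) = refl

⌊_⌋ : FinSet⁺ → FinSet
⌊ B ⌋ = record { Carrier = Carrier⁺ B ; size = suc (pred B) ; enc = enc⁺ B }

-- Linear species and operads over a field K (species formalism: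
-- components indexed by nonempty finite sets, relabelling along
-- bijections; partial composition at the point ∗ = nothing of A ⊔ {∗}).

module _ (K : CharZeroField) where
  private
    module R = CommutativeRing (CharZeroField.cring K)
  open CharZeroField K using (cring)

  record RawSpecies : Set₁ where
    infix 4 _≈_
    infixl 6 _+_
    infixr 7 _·_
    field
      El      : FinSet⁺ → Set
      _≈_     : ∀ {A} → El A → El A → Set
      _+_     : ∀ {A} → El A → El A → El A
      0v      : ∀ {A} → El A
      -_      : ∀ {A} → El A → El A
      _·_     : ∀ {A} → R.Carrier → El A → El A
      relabel : ∀ {A B} → (Carrier⁺ A ↔ Carrier⁺ B) → El A → El B

  record IsSpecies (S : RawSpecies) : Set₁ where
    open RawSpecies S
    field
      isModule     : ∀ A → IsModule cring (_≈_ {A}) _+_ 0v -_ _·_ (λ x c → c · x)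
      relabel-cong : ∀ {A B} (σ : Carrier⁺ A ↔ Carrier⁺ B) {x y : El A} → x ≈ y → relabel {A} {B} σ x ≈ relabel {A} {B} σ y
      relabel-+    : ∀ {A B} (σ : Carrier⁺ A ↔ Carrier⁺ B) (x y : El A) → relabel {A} {B} σ (x + y) ≈ relabel {A} {B} σ x + relabel {A} {B} σ y
      relabel-·    : ∀ {A B} (σ : Carrier⁺ A ↔ Carrier⁺ B) c (x : El A) → relabel {A} {B} σ (c · x) ≈ c · relabel {A} {B} σ x
      relabel-id   : ∀ {A} (x : El A) → relabel {A} {A} ↔-refl x ≈ x
      relabel-∘    : ∀ {A B C} (σ : Carrier⁺ A ↔ Carrier⁺ B) (τ : Carrier⁺ B ↔ Carrier⁺ C) (x : El A) →
                     relabel {A} {C} (↔-trans σ τ) x ≈ relabel {B} {C} τ (relabel {A} {B} σ x)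
      relabel-ext  : ∀ {A B} (σ τ : Carrier⁺ A ↔ Carrier⁺ B) → (∀ a → Inverse.to σ a ≡ Inverse.to τ a) →
                     ∀ (x : El A) → relabel {A} {B} σ x ≈ relabel {A} {B} τ x

  record Species : Set₁ where
    field
      raw       : RawSpecies
      isSpecies : IsSpecies raw

  -- raw operad: species + unit (on a one-point set) + partial compositions
  -- ∘ : P[A ⊔ {∗}] ⊗ P[B] → P[A ⊔ B]  (written bilinearly)
  record RawOperad : Set₁ where
    field
      species : RawSpecies
    open RawSpecies species
    infixl 8 _∘ₒ_
    field
      unit : El (Maybe⁺ ∅)
      _∘ₒ_ : ∀ {A : FinSet} {B : FinSet⁺} → El (Maybe⁺ A) → El B → El (A ⊎⁺ B)

  record IsOperad (P : RawOperad) : Set₁ where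
    open RawOperad P
    open RawSpecies species
    field
      isSpecies : IsSpecies species
      ∘-cong  : ∀ {A B} {x x' : El (Maybe⁺ A)} {y y' : El B} → x ≈ x' → y ≈ y' → x ∘ₒ y ≈ x' ∘ₒ y'
      ∘-+ˡ    : ∀ {A B} (x x' : El (Maybe⁺ A)) (y : El B) → (x + x') ∘ₒ y ≈ x ∘ₒ y + x' ∘ₒ y
      ∘-+ʳ    : ∀ {A B} (x : El (Maybe⁺ A)) (y y' : El B) → x ∘ₒ (y + y') ≈ x ∘ₒ y + x ∘ₒ y'
      ∘-·ˡ    : ∀ {A B} c (x : El (Maybe⁺ A)) (y : El B) → (c · x) ∘ₒ y ≈ c · (x ∘ₒ y)
      ∘-·ʳ    : ∀ {A B} c (x : El (Maybe⁺ A)) (y : El B) → x ∘ₒ (c · y) ≈ c · (x ∘ₒ y)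
      ∘-equiv : ∀ {A A' : FinSet} {B B' : FinSet⁺} (σ : Carrier A ↔ Carrier A') (τ : Carrier⁺ B ↔ Carrier⁺ B')
                  (x : El (Maybe⁺ A)) (y : El B) →
                relabel {Maybe⁺ A} {Maybe⁺ A'} (maybe-↔ σ) x ∘ₒ relabel τ y
                  ≈ relabel {A ⊎⁺ B} {A' ⊎⁺ B'} (σ ⊎-↔ τ) (x ∘ₒ y)
      unitˡ   : ∀ {B} (y : El B) → unit ∘ₒ y ≈ relabel ⊥⊎↔ y
      unitʳ   : ∀ {A} (x : El (Maybe⁺ A)) → x ∘ₒ unit ≈ relabel unitʳ↔ x
      ∘-seq   : ∀ {A B : FinSet} {C : FinSet⁺} (x : El (Maybe⁺ A)) (y : El (Maybe⁺ B)) (z : El C) →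
                relabel {(A ⊎ᶠ B) ⊎⁺ C} {A ⊎⁺ (B ⊎⁺ C)} assoc↔
                  (_∘ₒ_ {A ⊎ᶠ B} (relabel {A ⊎⁺ Maybe⁺ B} {Maybe⁺ (A ⊎ᶠ B)} seq↔ (x ∘ₒ y)) z)
                  ≈ x ∘ₒ (y ∘ₒ z)
      ∘-par   : ∀ {A : FinSet} {B C : FinSet⁺} (x : El (Maybe⁺ (Maybeᶠ A))) (y : El B) (z : El C) →
                relabel {(A ⊎ᶠ ⌊ B ⌋) ⊎⁺ C} {(A ⊎ᶠ ⌊ C ⌋) ⊎⁺ B} swap↔
                  (_∘ₒ_ {A ⊎ᶠ ⌊ B ⌋} (relabel {Maybeᶠ A ⊎⁺ B} {Maybe⁺ (A ⊎ᶠ ⌊ B ⌋)} par↔ (x ∘ₒ y)) z)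
                  ≈ _∘ₒ_ {A ⊎ᶠ ⌊ C ⌋} (relabel {Maybeᶠ A ⊎⁺ C} {Maybe⁺ (A ⊎ᶠ ⌊ C ⌋)} par↔
                        (relabel {Maybe⁺ (Maybeᶠ A)} {Maybe⁺ (Maybeᶠ A)} exch↔ x ∘ₒ z)) y

  record Operad : Set₁ where
    field
      raw      : RawOperad
      isOperad : IsOperad raw

  record SpMor (H S : RawSpecies) : Set₁ where
    private
      module H = RawSpecies H
      module S = RawSpecies S
    field
      map      : ∀ {A} → H.El A → S.El A
      map-cong : ∀ {A} {x y : H.El A} → x H.≈ y → map x S.≈ map y
      map-+    : ∀ {A} (x y : H.El A) → map (x H.+ y) S.≈ map x S.+ map y
      map-·    : ∀ {A} c (x : H.El A) → map (c H.· x) S.≈ c S.· map x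
      map-nat  : ∀ {A B} (σ : Carrier⁺ A ↔ Carrier⁺ B) (x : H.El A) → map (H.relabel {A} {B} σ x) S.≈ S.relabel {A} {B} σ (map x)
  open SpMor public

  record OpMor (P Q : RawOperad) : Set₁ where
    private
      module P = RawOperad P
      module Q = RawOperad Q
      module PS = RawSpecies P.species
      module QS = RawSpecies Q.species
    field
      spMor    : SpMor P.species Q.species
      map-unit : map spMor P.unit QS.≈ Q.unit
      map-∘    : ∀ {A B} (x : PS.El (Maybe⁺ A)) (y : PS.El B) →
                 map spMor (x P.∘ₒ y) QS.≈ (map spMor x Q.∘ₒ map spMor y)
  open OpMor public

  -- P is free: there are a species H and a species map ι : H → P with the
  -- universal property of the free operad on H (so P ≅ free operad on H)
  IsFree : RawOperad → Set₁
  IsFree P =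
    Σ[ H ∈ Species ] Σ[ ι ∈ SpMor (Species.raw H) (RawOperad.species P) ]
      (∀ (Q : Operad) (f : SpMor (Species.raw H) (RawOperad.species (Operad.raw Q))) →
        let open RawSpecies (RawOperad.species (Operad.raw Q)) using (_≈_) in
        Σ[ F ∈ OpMor P (Operad.raw Q) ]
          ((∀ {A} h → map (spMor F) {A} (map ι h) ≈ map f h)
          × (∀ (G : OpMor P (Operad.raw Q)) → (∀ {A} h → map (spMor G) {A} (map ι h) ≈ map f h) →
               ∀ {A} x → map (spMor G) {A} x ≈ map (spMor F) x)))

  module _ (P : RawOperad) where
    open RawOperad P
    open RawSpecies species

    Family : Set₁
    Family = List (Σ FinSet⁺ El)

    data Gen (F : Family) : (A : FinSet⁺) → El A → Set₁ where
      gen      : (i : Fin (length F)) → Gen F (proj₁ (lookup F i)) (proj₂ (lookup F i))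
      gunit    : Gen F (Maybe⁺ ∅) unit
      gzero    : ∀ {A} → Gen F A 0v
      gadd     : ∀ {A x y} → Gen F A x → Gen F A y → Gen F A (x + y)
      gscale   : ∀ {A x} c → Gen F A x → Gen F A (c · x)
      grelabel : ∀ {A B x} (σ : Carrier⁺ A ↔ Carrier⁺ B) → Gen F A x → Gen F B (relabel σ x)
      gcomp    : ∀ {A B x y} → Gen F (Maybe⁺ A) x → Gen F B y → Gen F (A ⊎⁺ B) (x ∘ₒ y)
      gresp    : ∀ {A x y} → Gen F A x → x ≈ y → Gen F A y

    Generates : Family → Set₁
    Generates F = ∀ (A : FinSet⁺) (x : El A) → Gen F A x

    FinitelyGenerated : Set₁
    FinitelyGenerated = Σ[ F ∈ Family ] Generates F

  -- A graph on a nonempty finite set V is encoded by any Boolean relation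
  -- r : V → V → Bool; it represents the graph whose edges are the pairs
  -- {u,v}, u ≠ v, with r u v or r v u (see 'edge').  Two relations encode
  -- the same graph iff 'sameGraph' holds.  An element of 𝕂𝐆[V] is a formal
  -- linear combination (list of coefficient/graph pairs); two such are equal
  -- iff every graph has the same total coefficient in both ('coeff').

  Rel : FinSet⁺ → Set
  Rel V = Carrier⁺ V → Carrier⁺ V → Bool

  eqᵇ : (V : FinSet⁺) → Carrier⁺ V → Carrier⁺ V → Bool
  eqᵇ V a b = isYes (Inverse.to (enc⁺ V) a ≟F Inverse.to (enc⁺ V) b)

  edge : (V : FinSet⁺) → Rel V → Carrier⁺ V → Carrier⁺ V → Bool
  edge V r a b = not (eqᵇ V a b) ∧ (r a b ∨ r b a)

  elems : (V : FinSet⁺) → List (Carrier⁺ V)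
  elems V = L.map (Inverse.from (enc⁺ V)) (allFin (suc (pred V)))

  private
    allᵇ : {X : Set} → (X → Bool) → List X → Bool
    allᵇ p = foldr (λ x acc → p x ∧ acc) true

    _==ᵇ_ : Bool → Bool → Bool
    true  ==ᵇ b = b
    false ==ᵇ b = not b

  sameGraph : (V : FinSet⁺) → Rel V → Rel V → Bool
  sameGraph V r s = allᵇ (λ a → allᵇ (λ b → edge V r a b ==ᵇ edge V s a b) (elems V)) (elems V)

  LinComb : FinSet⁺ → Set
  LinComb V = List (R.Carrier × Rel V)

  coeff : (V : FinSet⁺) → LinComb V → Rel V → R.Carrier
  coeff V u g = foldr (λ p acc → if sameGraph V (proj₂ p) g then proj₁ p R.+ acc else acc) R.0# u

  -- enumeration of the maps N → Fin (suc m) where N ⊆ Fin n is given by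
  -- adj (indices outside N are sent to a fixed dummy value)
  private
    consF : ∀ {n m} → Fin m → (Fin n → Fin m) → Fin (suc n) → Fin m
    consF j h fzero    = j
    consF j h (fsuc i) = h i

  assignments : (n m : ℕ) → (Fin n → Bool) → List (Fin n → Fin (suc m))
  assignments zero    m adj = [ (λ ()) ]
  assignments (suc n) m adj =
    concatMap (λ h → L.map (λ j → consF j h) (if adj fzero then allFin (suc m) else [ fzero ]))
              (assignments n m (adj ∘ fsuc))

  -- the graph (g₁ ∖ {∗}) ∪ g₂ ∪ {{v, f v} | v ∈ N∗}
  glue : (A : FinSet) (B : FinSet⁺) → Rel (Maybe⁺ A) → Rel B → (Carrier A → Carrier⁺ B) → Rel (A ⊎⁺ B)
  glue A B g₁ g₂ f (inj₁ a) (inj₁ a') = g₁ (just a) (just a')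
  glue A B g₁ g₂ f (inj₂ b) (inj₂ b') = g₂ b b'
  glue A B g₁ g₂ f (inj₁ a) (inj₂ b)  = edge (Maybe⁺ A) g₁ nothing (just a) ∧ eqᵇ B (f a) b
  glue A B g₁ g₂ f (inj₂ b) (inj₁ a)  = false

  -- g₁ ∘∗ g₂ = Σ_{f : N∗ → V₂} glue g₁ g₂ f
  composeGraphs : (A : FinSet) (B : FinSet⁺) → Rel (Maybe⁺ A) → Rel B → LinComb (A ⊎⁺ B)
  composeGraphs A B g₁ g₂ =
    L.map (λ h → R.1# , glue A B g₁ g₂ (λ a → Inverse.from (enc⁺ B) (h (Inverse.to (enc A) a))))
          (assignments (size A) (pred B) (λ i → edge (Maybe⁺ A) g₁ nothing (just (Inverse.from (enc A) i))))

  KGspecies : RawSpecies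
  KGspecies = record
    { El      = LinComb
    ; _≈_     = λ {V} u v → ∀ (g : Rel V) → coeff V u g R.≈ coeff V v g
    ; _+_     = _++_
    ; 0v      = []
    ; -_      = L.map (λ p → R.- proj₁ p , proj₂ p)
    ; _·_     = λ c → L.map (λ p → c R.* proj₁ p , proj₂ p)
    ; relabel = λ σ → L.map (λ p → proj₁ p , λ b b' → proj₂ p (Inverse.from σ b) (Inverse.from σ b'))
    }

  KG : RawOperad
  KG = record
    { species = KGspecies
    ; unit    = [ (R.1# , λ _ _ → false) ]
    ; _∘ₒ_    = λ {A} {B} x y →
        concatMap (λ p → concatMap (λ q →
          L.map (λ r → proj₁ p R.* proj₁ q R.* proj₁ r , proj₂ r) (composeGraphs A B (proj₂ p) (proj₂ q))) y) x
    }

module Submission where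

open import Defs
open import Data.Product using (_×_)
open import Relation.Nullary using (¬_)

open import Algebra.Bundles using (CommutativeRing)
open import Algebra.Module.Bundles using (LeftModule)
import Algebra.Module.Construct.DirectProduct as DirectProduct
import Algebra.Module.Construct.TensorUnit as TensorUnit
open import Algebra.Module.Structures using (IsModule)
open import Algebra.Module.Structures.Biased using (IsModuleFromLeft)
import Algebra.Properties.Group as GroupProperties
import Algebra.Solver.Ring.NaturalCoefficients.Default as NaturalCoefficients
open import Data.Bool using (Bool; true; false; _∧_; _∨_; not; if_then_else_)
open import Data.Bool.Properties using (⇔→≡; ¬-not; ∧-identityʳ; ∨-identityʳ; ∨-comm)
open import Data.Fin using (Fin) renaming (zero to fzero; suc to fsuc)
open import Data.Fin.Properties using (0↔⊥; 1↔⊤; cantor-schröder-bernstein) renaming (_≟_ to _≟F_)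
open import Data.List using (List; []; _∷_; [_]; _++_; foldr; concatMap; lookup)
import Data.List as L
open import Data.List.Membership.Propositional using (_∈_)
open import Data.List.Membership.Propositional.Properties using (∈-map⁺; ∈-allFin)
open import Data.List.Relation.Unary.Any using (here; there)
open import Data.Maybe using (Maybe; just; nothing)
open import Data.Nat.Base as ℕ using (ℕ; zero; suc)
import Data.Nat.Properties as ℕ
open import Data.Product using (Σ-syntax; _,_; proj₁; proj₂)
open import Data.Sum using (_⊎_; inj₁; inj₂)
open import Data.Sum.Function.Propositional using (_⊎-↔_)
open import Data.Unit using (⊤; tt)
open import Function using (_∘_)
open import Function.Bundles using (_↔_; _⇔_; Inverse; Injection; Equivalence; mk⇔; mk↔ₛ′)
open import Function.Definitions using (Injective)
import Function.Properties.Equivalence as ⇔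
open import Function.Properties.Inverse using (↔-refl; ↔-sym; ↔-trans; ↔⇒↣)
open import Level using (0ℓ)
open import Relation.Binary.PropositionalEquality
  using (_≡_; _≢_; _≗_; refl; sym; trans; cong; cong₂; subst; subst₂; module ≡-Reasoning)
import Relation.Binary.Reasoning.Setoid as SetoidReasoning
open import Relation.Nullary using (yes; no; contradiction)

-- Both halves are read off the coefficients of the empty and of the complete graph.
--
-- Grafting a graph on at least two vertices into a graph on at least two vertices never produces a
-- complete graph, since each remaining vertex of the outer graph is joined to at most one vertex of
-- the inner one; grafting with a one-vertex graph merely rescales the other factor. Hence everything
-- generated by graphs on at most N vertices has coefficient zero on the complete graphs with more
-- than N vertices.
--
-- Let 𝔸 = 𝕂[ε]/(ε³) and send x ∈ 𝕂𝐆[V] to Ψ x = (sum of the coefficients of x) · ε^(2(|V| - 1)),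
-- an operad morphism into the commutative operad over 𝔸. If 𝕂𝐆 were free on ι : H → 𝕂𝐆, the linear
-- map swapping the coordinates of ε and ε², composed with Ψ ∘ ι, would extend to an operad morphism
-- Φ. The algebra map θ : ε ↦ ε² undoes the swap on the image of Ψ, so θ ∘ Φ and Ψ agree on
-- generators and hence everywhere. Thus Φ sends both graphs on two vertices to elements ε + tε², and
-- both of their composites have ε²-coefficient 1. But grafting the edge into the empty graph gives
-- the sum of two relabellings of the opposite composite, and relabelling is trivial on 𝔸: 1 = 2 in 𝕂.

foldr-∧≡true⇒ : {X : Set} (l : List X) {P : X → Bool} →
                foldr (λ x acc → P x ∧ acc) true l ≡ true → ∀ {x} → x ∈ l → P x ≡ true
foldr-∧≡true⇒ (x ∷ l) {P} h (here refl) with P x | h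
... | true  | _  = refl
... | false | ()
foldr-∧≡true⇒ (y ∷ l) {P} h (there x∈l) with P y | h
... | true  | h′ = foldr-∧≡true⇒ l h′ x∈l
... | false | ()

foldr-∧≡false⇒ : {X : Set} (l : List X) {P : X → Bool} →
                 foldr (λ x acc → P x ∧ acc) true l ≡ false → Σ[ x ∈ X ] P x ≡ false
foldr-∧≡false⇒ (x ∷ l) {P} h with P x in Px
... | true  = foldr-∧≡false⇒ l h
... | false = x , Px

not-∧-cong : ∀ {e e′ x y} → e ≡ e′ → (e′ ≡ false → x ≡ y) → not e ∧ x ≡ not e′ ∧ y
not-∧-cong {e′ = true}  refl _   = refl
not-∧-cong {e′ = false} refl x≡y = x≡y refl

∧≡true⇒ʳ : ∀ {x y} → x ∧ y ≡ true → y ≡ true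
∧≡true⇒ʳ {true} y≡true = y≡true

↔-injective : {A B : Set} (σ : A ↔ B) → Injective _≡_ _≡_ (Inverse.to σ)
↔-injective σ = Injection.injective (↔⇒↣ σ)

Fin1-irrelevant : (i j : Fin 1) → i ≡ j
Fin1-irrelevant i j = trans (sym (Inverse.strictlyInverseʳ 1↔⊤ i)) (Inverse.strictlyInverseʳ 1↔⊤ j)

module _ (K : CharZeroField) where
  open CharZeroField K using (cring; 1≉0)
  module R = CommutativeRing cring
  open R using (_≈_; _+_; _*_; 0#; 1#) renaming (Carrier to 𝕂)
  open NaturalCoefficients R.commutativeSemiring using (solve; _:=_; _:+_; _:*_; con; Polynomial)

  -- Graphs, up to equality of edge sets

  to⁺ : (V : FinSet⁺) → Carrier⁺ V → Fin (suc (pred V))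
  to⁺ V = Inverse.to (enc⁺ V)

  from⁺ : (V : FinSet⁺) → Fin (suc (pred V)) → Carrier⁺ V
  from⁺ V = Inverse.from (enc⁺ V)

  ∈-elems : ∀ V a → a ∈ elems K V
  ∈-elems V a = subst (_∈ elems K V) (Inverse.strictlyInverseʳ (enc⁺ V) a) (∈-map⁺ (from⁺ V) (∈-allFin (to⁺ V a)))

  singleton-irrelevant : ∀ V → pred V ≡ 0 → (a b : Carrier⁺ V) → a ≡ b
  singleton-irrelevant V refl a b = ↔-injective (enc⁺ V) (Fin1-irrelevant (to⁺ V a) (to⁺ V b))

  ↔⇒pred≡ : ∀ V W → Carrier⁺ V ↔ Carrier⁺ W → pred V ≡ pred W
  ↔⇒pred≡ V W σ = ℕ.suc-injective (cantor-schröder-bernstein (↔-injective τ) (↔-injective (↔-sym τ)))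
    where
    τ : Fin (suc (pred V)) ↔ Fin (suc (pred W))
    τ = ↔-trans (↔-sym (enc⁺ V)) (↔-trans σ (enc⁺ W))

  eqᵇ≡true⇔ : ∀ V {a b} → eqᵇ K V a b ≡ true ⇔ a ≡ b
  eqᵇ≡true⇔ V {a} {b} with to⁺ V a ≟F to⁺ V b
  ... | yes p = mk⇔ (λ _ → ↔-injective (enc⁺ V) p) (λ _ → refl)
  ... | no ¬p = mk⇔ (λ ()) (λ a≡b → contradiction (cong (to⁺ V) a≡b) ¬p)

  eqᵇ-refl : ∀ V a → eqᵇ K V a a ≡ true
  eqᵇ-refl V a = Equivalence.from (eqᵇ≡true⇔ V) refl

  eqᵇ-≢ : ∀ V {a b} → a ≢ b → eqᵇ K V a b ≡ false
  eqᵇ-≢ V a≢b = ¬-not (a≢b ∘ Equivalence.to (eqᵇ≡true⇔ V))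

  eqᵇ-injective : ∀ V W {φ : Carrier⁺ V → Carrier⁺ W} → Injective _≡_ _≡_ φ →
                  ∀ a b → eqᵇ K W (φ a) (φ b) ≡ eqᵇ K V a b
  eqᵇ-injective V W {φ} φ-inj a b =
    ⇔→≡ (⇔.trans (eqᵇ≡true⇔ W) (⇔.trans (mk⇔ φ-inj (cong φ)) (⇔.sym (eqᵇ≡true⇔ V))))

  edge-≢ : ∀ V r {a b} → a ≢ b → edge K V r a b ≡ (r a b ∨ r b a)
  edge-≢ V r a≢b = cong (λ e → not e ∧ _) (eqᵇ-≢ V a≢b)

  edge-irreflexive : ∀ V r a → edge K V r a a ≡ false
  edge-irreflexive V r a rewrite eqᵇ-refl V a = refl

  -- The Boolean comparison inside sameGraph is private to Defs; it computes once the two edge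
  -- values are abstracted.
  sameGraph-sound : ∀ V r s → sameGraph K V r s ≡ true → ∀ a b → edge K V r a b ≡ edge K V s a b
  sameGraph-sound V r s h a b
    with edge K V r a b | edge K V s a b
       | foldr-∧≡true⇒ (elems K V) (foldr-∧≡true⇒ (elems K V) h (∈-elems V a)) (∈-elems V b)
  ... | true  | true  | _  = refl
  ... | false | false | _  = refl
  ... | true  | false | ()
  ... | false | true  | ()

  sameGraph-complete : ∀ V r s → (∀ a b → edge K V r a b ≡ edge K V s a b) → sameGraph K V r s ≡ true
  sameGraph-complete V r s r≗s with sameGraph K V r s in eq
  ... | true  = refl
  ... | false with foldr-∧≡false⇒ (elems K V) eq
  ... | a , ha with foldr-∧≡false⇒ (elems K V) ha
  ... | b , hab with edge K V r a b | edge K V s a b | r≗s a b | hab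
  ... | true  | .true  | refl | ()
  ... | false | .false | refl | ()

  Carries : ∀ V W → (Carrier⁺ V → Carrier⁺ W) → Rel K V → Rel K W → Set
  Carries V W φ r r′ = ∀ a b → edge K W r′ (φ a) (φ b) ≡ edge K V r a b

  carries : ∀ V W {φ : Carrier⁺ V → Carrier⁺ W} (r : Rel K V) (r′ : Rel K W) → Injective _≡_ _≡_ φ →
            (∀ a b → a ≢ b → (r′ (φ a) (φ b) ∨ r′ (φ b) (φ a)) ≡ (r a b ∨ r b a)) → Carries V W φ r r′
  carries V W r r′ φ-inj h a b = not-∧-cong (eqᵇ-injective V W φ-inj a b) λ a≢ᵇb →
    h a b λ a≡b → contradiction (trans (sym a≢ᵇb) (Equivalence.from (eqᵇ≡true⇔ V) a≡b)) λ ()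

  sameGraph-↔ : ∀ V W (σ : Carrier⁺ V ↔ Carrier⁺ W) r s r′ s′ →
                Carries V W (Inverse.to σ) r r′ → Carries V W (Inverse.to σ) s s′ →
                sameGraph K W r′ s′ ≡ sameGraph K V r s
  sameGraph-↔ V W σ r s r′ s′ hr hs = ⇔→≡ (mk⇔ pull push)
    where
    open Inverse σ using (to; from; strictlyInverseˡ)
    pull : sameGraph K W r′ s′ ≡ true → sameGraph K V r s ≡ true
    pull h = sameGraph-complete V r s λ a b →
      trans (sym (hr a b)) (trans (sameGraph-sound W r′ s′ h (to a) (to b)) (hs a b))
    push : sameGraph K V r s ≡ true → sameGraph K W r′ s′ ≡ true
    push h = sameGraph-complete W r′ s′ λ a b →
      subst₂ (λ u v → edge K W r′ u v ≡ edge K W s′ u v) (strictlyInverseˡ a) (strictlyInverseˡ b)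
        (trans (hr (from a) (from b)) (trans (sameGraph-sound V r s h (from a) (from b)) (sym (hs (from a) (from b)))))

  constGraph : (V : FinSet⁺) → Bool → Rel K V
  constGraph V c _ _ = c

  isConst : (V : FinSet⁺) → Bool → Rel K V → Bool
  isConst V c r = sameGraph K V r (constGraph V c)

  isConst-↔ : ∀ V W (σ : Carrier⁺ V ↔ Carrier⁺ W) c r r′ →
              Carries V W (Inverse.to σ) r r′ → isConst W c r′ ≡ isConst V c r
  isConst-↔ V W σ c r r′ hr = sameGraph-↔ V W σ r (constGraph V c) r′ (constGraph W c) hr
    (carries V W (constGraph V c) (constGraph W c) (↔-injective σ) λ _ _ _ → refl)

  singleton-sameGraph : ∀ V → pred V ≡ 0 → ∀ r s → sameGraph K V r s ≡ true
  singleton-sameGraph V V₀ r s = sameGraph-complete V r s λ a b →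
    subst (λ c → edge K V r a c ≡ edge K V s a c) (singleton-irrelevant V V₀ a b)
      (trans (edge-irreflexive V r a) (sym (edge-irreflexive V s a)))

  isConst-relabel : ∀ V W (σ : Carrier⁺ V ↔ Carrier⁺ W) c r →
                    isConst W c (λ b b′ → r (Inverse.from σ b) (Inverse.from σ b′)) ≡ isConst V c r
  isConst-relabel V W σ c r = isConst-↔ V W σ c r r′ (carries V W r r′ (↔-injective σ) λ a b _ →
    subst₂ (λ u v → (r u v ∨ r v u) ≡ (r a b ∨ r b a)) (sym (strictlyInverseʳ a)) (sym (strictlyInverseʳ b)) refl)
    where
    open Inverse σ using (from; strictlyInverseʳ)
    r′ : Rel K W
    r′ b b′ = r (from b) (from b′)

  glue-unaryˡ : ∀ A B → size A ≡ 0 → ∀ g₁ g₂ f c → isConst (A ⊎⁺ B) c (glue K A B g₁ g₂ f) ≡ isConst B c g₂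
  glue-unaryˡ A B refl g₁ g₂ f c = isConst-↔ B (A ⊎⁺ B) σ c g₂ (glue K A B g₁ g₂ f)
    (carries B (A ⊎⁺ B) g₂ (glue K A B g₁ g₂ f) (↔-injective σ) λ _ _ _ → refl)
    where
    σ : Carrier⁺ B ↔ (Carrier A ⊎ Carrier⁺ B)
    σ = ↔-trans ⊥⊎↔ (↔-sym (↔-trans (enc A) 0↔⊥) ⊎-↔ ↔-refl)

  glue-unaryʳ : ∀ A B → pred B ≡ 0 → ∀ g₁ g₂ f c →
                isConst (A ⊎⁺ B) c (glue K A B g₁ g₂ f) ≡ isConst (Maybe⁺ A) c g₁
  glue-unaryʳ A B B₀@refl g₁ g₂ f c = isConst-↔ (Maybe⁺ A) (A ⊎⁺ B) σ c g₁ (glue K A B g₁ g₂ f)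
    (carries (Maybe⁺ A) (A ⊎⁺ B) g₁ (glue K A B g₁ g₂ f) (↔-injective σ) glue≗g₁)
    where
    σ : Maybe (Carrier A) ↔ (Carrier A ⊎ Carrier⁺ B)
    σ = ↔-trans unitʳ↔ (↔-refl ⊎-↔ ↔-trans (maybe-↔ (↔-sym 0↔⊥)) (↔-trans (maybeFin 0) (↔-sym (enc⁺ B))))
    open ≡-Reasoning
    root-edge : ∀ a → (edge K (Maybe⁺ A) g₁ nothing (just a) ∧ eqᵇ K B (f a) (from⁺ B fzero))
                      ≡ (g₁ nothing (just a) ∨ g₁ (just a) nothing)
    root-edge a = begin
      edge K (Maybe⁺ A) g₁ nothing (just a) ∧ eqᵇ K B (f a) (from⁺ B fzero)
        ≡⟨ cong (edge K (Maybe⁺ A) g₁ nothing (just a) ∧_)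
                (subst (λ b → eqᵇ K B b _ ≡ true) (singleton-irrelevant B B₀ _ (f a)) (eqᵇ-refl B _)) ⟩
      edge K (Maybe⁺ A) g₁ nothing (just a) ∧ true
        ≡⟨ ∧-identityʳ _ ⟩
      edge K (Maybe⁺ A) g₁ nothing (just a)
        ≡⟨ edge-≢ (Maybe⁺ A) g₁ (λ ()) ⟩
      g₁ nothing (just a) ∨ g₁ (just a) nothing ∎
    glue≗g₁ : ∀ u v → u ≢ v → (glue K A B g₁ g₂ f (Inverse.to σ u) (Inverse.to σ v) ∨
                                glue K A B g₁ g₂ f (Inverse.to σ v) (Inverse.to σ u)) ≡ (g₁ u v ∨ g₁ v u)
    glue≗g₁ nothing  nothing   u≢v = contradiction refl u≢v
    glue≗g₁ nothing  (just a)  _   = root-edge a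
    glue≗g₁ (just a) nothing   _   = trans (∨-identityʳ _) (trans (root-edge a) (∨-comm (g₁ nothing (just a)) _))
    glue≗g₁ (just a) (just a′) _   = refl

  -- A vertex a of A is joined to the single vertex f a of B, but B has at least two vertices.
  glue-not-complete : ∀ A B {m n} → size A ≡ suc m → pred B ≡ suc n → ∀ g₁ g₂ f →
                      isConst (A ⊎⁺ B) true (glue K A B g₁ g₂ f) ≡ false
  glue-not-complete A B refl refl g₁ g₂ f = ¬-not λ complete → b₀≢b₁ (trans (sym (hits complete b₀)) (hits complete b₁))
    where
    a : Carrier A
    a = Inverse.from (enc A) fzero
    b₀ b₁ : Carrier⁺ B
    b₀ = from⁺ B fzero
    b₁ = from⁺ B (fsuc fzero)
    b₀≢b₁ : b₀ ≢ b₁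
    b₀≢b₁ b₀≡b₁ with ↔-injective (↔-sym (enc⁺ B)) b₀≡b₁
    ... | ()
    open ≡-Reasoning
    hits : isConst (A ⊎⁺ B) true (glue K A B g₁ g₂ f) ≡ true → ∀ b → f a ≡ b
    hits complete b = Equivalence.to (eqᵇ≡true⇔ B) (∧≡true⇒ʳ (begin
      edge K (Maybe⁺ A) g₁ nothing (just a) ∧ eqᵇ K B (f a) b
        ≡⟨ sym (∨-identityʳ _) ⟩
      (edge K (Maybe⁺ A) g₁ nothing (just a) ∧ eqᵇ K B (f a) b) ∨ false
        ≡⟨ sym (edge-≢ (A ⊎⁺ B) (glue K A B g₁ g₂ f) (λ ())) ⟩
      edge K (A ⊎⁺ B) (glue K A B g₁ g₂ f) (inj₁ a) (inj₂ b)
        ≡⟨ sameGraph-sound (A ⊎⁺ B) (glue K A B g₁ g₂ f) (constGraph (A ⊎⁺ B) true) complete (inj₁ a) (inj₂ b) ⟩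
      edge K (A ⊎⁺ B) (constGraph (A ⊎⁺ B) true) (inj₁ a) (inj₂ b)
        ≡⟨ edge-≢ (A ⊎⁺ B) (constGraph (A ⊎⁺ B) true) (λ ()) ⟩
      true ∎))

  -- Coefficients of linear combinations of graphs

  ⟦_⟧ : Bool → 𝕂
  ⟦ true  ⟧ = 1#
  ⟦ false ⟧ = 0#

  -- coeff K V x g unfolds to weight (λ r → sameGraph K V r g) x.
  weight : {X : Set} → (X → Bool) → List (𝕂 × X) → 𝕂
  weight P = foldr (λ p acc → if P (proj₂ p) then proj₁ p + acc else acc) 0#

  weight-∷ : {X : Set} (P : X → Bool) → ∀ p u → weight P (p ∷ u) ≈ proj₁ p * ⟦ P (proj₂ p) ⟧ + weight P u
  weight-∷ P (c , x) u with P x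
  ... | true  = R.+-congʳ (R.sym (R.*-identityʳ c))
  ... | false = R.sym (R.trans (R.+-congʳ (R.zeroʳ c)) (R.+-identityˡ _))

  weight-++ : {X : Set} (P : X → Bool) → ∀ u v → weight P (u ++ v) ≈ weight P u + weight P v
  weight-++ P []            v = R.sym (R.+-identityˡ _)
  weight-++ P ((c , x) ∷ u) v with P x
  ... | true  = R.trans (R.+-congˡ (weight-++ P u v)) (R.sym (R.+-assoc c _ _))
  ... | false = weight-++ P u v

  weight-scale : {X : Set} (P : X → Bool) → ∀ c u → weight P (L.map (λ p → c * proj₁ p , proj₂ p) u) ≈ c * weight P u
  weight-scale P c []            = R.sym (R.zeroʳ c)
  weight-scale P c ((d , x) ∷ u) with P x
  ... | true  = R.trans (R.+-congˡ (weight-scale P c u)) (R.sym (R.distribˡ c d _))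
  ... | false = weight-scale P c u

  weight-map : {X Y : Set} (P : Y → Bool) (F : X → Y) →
               ∀ u → weight P (L.map (λ p → proj₁ p , F (proj₂ p)) u) ≡ weight (P ∘ F) u
  weight-map P F []      = refl
  weight-map P F (p ∷ u) rewrite weight-map P F u = refl

  weight-cong : {X : Set} {P Q : X → Bool} → P ≗ Q → ∀ u → weight P u ≡ weight Q u
  weight-cong P≗Q []      = refl
  weight-cong P≗Q (p ∷ u) rewrite P≗Q (proj₂ p) | weight-cong P≗Q u = refl

  weight-false : {X : Set} (u : List (𝕂 × X)) → weight (λ _ → false) u ≡ 0#
  weight-false []      = refl
  weight-false (_ ∷ u) = weight-false u

  weight-single : {X Y : Set} (P : X → Bool) (G : Y → X) →
                  ∀ {l h} → l ≡ [ h ] → weight P (L.map (λ y → 1# , G y) l) ≈ ⟦ P (G h) ⟧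
  weight-single P G {h = h} refl with P (G h)
  ... | true  = R.+-identityʳ 1#
  ... | false = R.refl

  weight-none : {X Y : Set} (P : X → Bool) (G : Y → X) →
                ∀ l → (∀ y → P (G y) ≡ false) → weight P (L.map (λ y → 1# , G y) l) ≡ 0#
  weight-none P G []      _ = refl
  weight-none P G (y ∷ l) none rewrite none y = weight-none P G l none

  compose : ∀ A B → LinComb K (Maybe⁺ A) → LinComb K B → LinComb K (A ⊎⁺ B)
  compose A B = RawOperad._∘ₒ_ (KG K) {A} {B}

  relabel : ∀ V W → (Carrier⁺ V ↔ Carrier⁺ W) → LinComb K V → LinComb K W
  relabel V W = RawSpecies.relabel (KGspecies K) {V} {W}

  weight-compose : ∀ A B (P : Rel K (A ⊎⁺ B) → Bool) (Q₁ : Rel K (Maybe⁺ A) → Bool) (Q₂ : Rel K B → Bool) →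
                   (∀ g₁ g₂ → weight P (composeGraphs K A B g₁ g₂) ≈ ⟦ Q₁ g₁ ⟧ * ⟦ Q₂ g₂ ⟧) →
                   ∀ x y → weight P (compose A B x y) ≈ weight Q₁ x * weight Q₂ y
  weight-compose A B P Q₁ Q₂ factor x y = columns x
    where
    open SetoidReasoning R.setoid
    term : 𝕂 × Rel K (Maybe⁺ A) → 𝕂 × Rel K B → LinComb K (A ⊎⁺ B)
    term p q = L.map (λ r → proj₁ p * proj₁ q * proj₁ r , proj₂ r) (composeGraphs K A B (proj₂ p) (proj₂ q))
    regroup : ∀ p q a b w → p * q * (a * b) + p * a * w ≈ p * a * (q * b + w)
    regroup = solve 5 (λ p q a b w → p :* q :* (a :* b) :+ p :* a :* w := p :* a :* (q :* b :+ w)) R.refl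
    row : ∀ p y → weight P (concatMap (term p) y) ≈ proj₁ p * ⟦ Q₁ (proj₂ p) ⟧ * weight Q₂ y
    row p []      = R.sym (R.zeroʳ _)
    row p (q ∷ y) = begin
      weight P (term p q ++ concatMap (term p) y)
        ≈⟨ weight-++ P (term p q) _ ⟩
      weight P (term p q) + weight P (concatMap (term p) y)
        ≈⟨ R.+-cong (R.trans (weight-scale P _ (composeGraphs K A B (proj₂ p) (proj₂ q))) (R.*-congˡ (factor (proj₂ p) (proj₂ q))))
                    (row p y) ⟩
      proj₁ p * proj₁ q * (⟦ Q₁ (proj₂ p) ⟧ * ⟦ Q₂ (proj₂ q) ⟧) + proj₁ p * ⟦ Q₁ (proj₂ p) ⟧ * weight Q₂ y
        ≈⟨ regroup (proj₁ p) (proj₁ q) _ _ _ ⟩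
      proj₁ p * ⟦ Q₁ (proj₂ p) ⟧ * (proj₁ q * ⟦ Q₂ (proj₂ q) ⟧ + weight Q₂ y)
        ≈⟨ R.*-congˡ (weight-∷ Q₂ q y) ⟨
      proj₁ p * ⟦ Q₁ (proj₂ p) ⟧ * weight Q₂ (q ∷ y) ∎
    columns : ∀ x → weight P (compose A B x y) ≈ weight Q₁ x * weight Q₂ y
    columns []      = R.sym (R.zeroˡ _)
    columns (p ∷ x) = begin
      weight P (concatMap (term p) y ++ compose A B x y)
        ≈⟨ weight-++ P (concatMap (term p) y) _ ⟩
      weight P (concatMap (term p) y) + weight P (compose A B x y)
        ≈⟨ R.+-cong (row p y) (columns x) ⟩
      proj₁ p * ⟦ Q₁ (proj₂ p) ⟧ * weight Q₂ y + weight Q₁ x * weight Q₂ y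
        ≈⟨ R.distribʳ _ _ _ ⟨
      (proj₁ p * ⟦ Q₁ (proj₂ p) ⟧ + weight Q₁ x) * weight Q₂ y
        ≈⟨ R.*-congʳ (weight-∷ Q₁ p x) ⟨
      weight Q₁ (p ∷ x) * weight Q₂ y ∎

  -- composeGraphs K A B g₁ g₂ unfolds to
  --   L.map (λ h → 1# , glue K A B g₁ g₂ (assignmentMap A B h)) (assignments K (size A) (pred B) (adjacency A g₁)).
  adjacency : ∀ A → Rel K (Maybe⁺ A) → Fin (size A) → Bool
  adjacency A g₁ i = edge K (Maybe⁺ A) g₁ nothing (just (Inverse.from (enc A) i))

  assignmentMap : ∀ A B → (Fin (size A) → Fin (suc (pred B))) → Carrier A → Carrier⁺ B
  assignmentMap A B h a = from⁺ B (h (Inverse.to (enc A) a))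

  assignments-into-one : ∀ n adj → Σ[ h ∈ (Fin n → Fin 1) ] assignments K n 0 adj ≡ [ h ]
  assignments-into-one zero    adj = _ , refl
  assignments-into-one (suc n) adj
    with assignments K n 0 (adj ∘ fsuc) | assignments-into-one n (adj ∘ fsuc) | adj fzero
  ... | _ | _ , refl | true  = _ , refl
  ... | _ | _ , refl | false = _ , refl

  assignments-unique : ∀ n m adj → n ≡ 0 ⊎ m ≡ 0 → Σ[ h ∈ (Fin n → Fin (suc m)) ] assignments K n m adj ≡ [ h ]
  assignments-unique n m adj (inj₁ refl) = _ , refl
  assignments-unique n m adj (inj₂ refl) = assignments-into-one n adj

  weight-composeGraphs-unique : ∀ A B g₁ g₂ (P : Rel K (A ⊎⁺ B) → Bool) {b} → size A ≡ 0 ⊎ pred B ≡ 0 →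
                                (∀ f → P (glue K A B g₁ g₂ f) ≡ b) → weight P (composeGraphs K A B g₁ g₂) ≈ ⟦ b ⟧
  weight-composeGraphs-unique A B g₁ g₂ P unary P-glue
    with assignments-unique (size A) (pred B) (adjacency A g₁) unary
  ... | h , unique = R.trans (weight-single P (glue K A B g₁ g₂ ∘ assignmentMap A B) unique) (R.reflexive (cong ⟦_⟧ (P-glue _)))

  weight-composeGraphs-none : ∀ A B g₁ g₂ (P : Rel K (A ⊎⁺ B) → Bool) →
                              (∀ f → P (glue K A B g₁ g₂ f) ≡ false) → weight P (composeGraphs K A B g₁ g₂) ≡ 0#
  weight-composeGraphs-none A B g₁ g₂ P P-glue = weight-none P (glue K A B g₁ g₂ ∘ assignmentMap A B)
    (assignments K (size A) (pred B) (adjacency A g₁)) (P-glue ∘ assignmentMap A B)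

  coeffᶜ : ∀ V → Bool → LinComb K V → 𝕂
  coeffᶜ V c = weight (isConst V c)

  coeffᶜ-compose-unaryˡ : ∀ A B → size A ≡ 0 → ∀ c x y →
                          coeffᶜ (A ⊎⁺ B) c (compose A B x y) ≈ coeffᶜ (Maybe⁺ A) false x * coeffᶜ B c y
  coeffᶜ-compose-unaryˡ A B A₀ c = weight-compose A B (isConst (A ⊎⁺ B) c) (isConst (Maybe⁺ A) false) (isConst B c) λ g₁ g₂ →
    R.trans (weight-composeGraphs-unique A B g₁ g₂ (isConst (A ⊎⁺ B) c) (inj₁ A₀) λ f → glue-unaryˡ A B A₀ g₁ g₂ f c)
            (R.sym (R.trans (R.*-congʳ (R.reflexive (cong ⟦_⟧ (singleton-sameGraph (Maybe⁺ A) A₀ g₁ (constGraph (Maybe⁺ A) false)))))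
                            (R.*-identityˡ _)))

  coeffᶜ-compose-unaryʳ : ∀ A B → pred B ≡ 0 → ∀ c x y →
                          coeffᶜ (A ⊎⁺ B) c (compose A B x y) ≈ coeffᶜ (Maybe⁺ A) c x * coeffᶜ B false y
  coeffᶜ-compose-unaryʳ A B B₀ c = weight-compose A B (isConst (A ⊎⁺ B) c) (isConst (Maybe⁺ A) c) (isConst B false) λ g₁ g₂ →
    R.trans (weight-composeGraphs-unique A B g₁ g₂ (isConst (A ⊎⁺ B) c) (inj₂ B₀) λ f → glue-unaryʳ A B B₀ g₁ g₂ f c)
            (R.sym (R.trans (R.*-congˡ (R.reflexive (cong ⟦_⟧ (singleton-sameGraph B B₀ g₂ (constGraph B false))))) (R.*-identityʳ _)))

  coeffᶜ-compose-complete : ∀ A B {m n} → size A ≡ suc m → pred B ≡ suc n →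
                            ∀ x y → coeffᶜ (A ⊎⁺ B) true (compose A B x y) ≈ 0#
  coeffᶜ-compose-complete A B A₊ B₊ x y = begin
    coeffᶜ (A ⊎⁺ B) true (compose A B x y)   ≈⟨ weight-compose A B _ (λ _ → true) (λ _ → false) vanish x y ⟩
    weight (λ _ → true) x * weight (λ _ → false) y ≡⟨ cong (weight (λ _ → true) x *_) (weight-false y) ⟩
    weight (λ _ → true) x * 0#               ≈⟨ R.zeroʳ _ ⟩
    0# ∎
    where
    open SetoidReasoning R.setoid
    vanish : ∀ g₁ g₂ → coeffᶜ (A ⊎⁺ B) true (composeGraphs K A B g₁ g₂) ≈ 1# * 0#
    vanish g₁ g₂ = R.trans (R.reflexive (weight-composeGraphs-none A B g₁ g₂ _ (glue-not-complete A B A₊ B₊ g₁ g₂)))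
                           (R.sym (R.zeroʳ 1#))

  coeffᶜ-relabel : ∀ V W (σ : Carrier⁺ V ↔ Carrier⁺ W) c x → coeffᶜ W c (relabel V W σ x) ≡ coeffᶜ V c x
  coeffᶜ-relabel V W σ c x = trans (weight-map (isConst W c) _ x) (weight-cong (isConst-relabel V W σ c) x)

  -- 𝕂𝐆 is not finitely generated

  aritySum : Family K (KG K) → ℕ
  aritySum []            = 0
  aritySum ((V , _) ∷ F) = pred V ℕ.+ aritySum F

  arity≤aritySum : ∀ F i → pred (proj₁ (lookup F i)) ℕ.≤ aritySum F
  arity≤aritySum ((V , _) ∷ F) fzero    = ℕ.m≤m+n (pred V) (aritySum F)
  arity≤aritySum ((V , _) ∷ F) (fsuc i) = ℕ.≤-trans (arity≤aritySum F i) (ℕ.m≤n+m (aritySum F) (pred V))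

  generated-complete-coeff≈0 : ∀ {F A x} → Gen K (KG K) F A x → aritySum F ℕ.< pred A → coeffᶜ A true x ≈ 0#
  generated-complete-coeff≈0 {F} (gen i) large = contradiction (arity≤aritySum F i) (ℕ.<⇒≱ large)
  generated-complete-coeff≈0 gunit ()
  generated-complete-coeff≈0 gzero _ = R.refl
  generated-complete-coeff≈0 (gadd {x = x} {y} gx gy) large =
    R.trans (weight-++ _ x y)
      (R.trans (R.+-cong (generated-complete-coeff≈0 gx large) (generated-complete-coeff≈0 gy large)) (R.+-identityˡ 0#))
  generated-complete-coeff≈0 (gscale {x = x} c gx) large =
    R.trans (weight-scale _ c x) (R.trans (R.*-congˡ (generated-complete-coeff≈0 gx large)) (R.zeroʳ c))
  generated-complete-coeff≈0 {F} (grelabel {A} {B} {x} σ gx) large =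
    R.trans (R.reflexive (coeffᶜ-relabel A B σ true x))
            (generated-complete-coeff≈0 gx (subst (aritySum F ℕ.<_) (sym (↔⇒pred≡ A B σ)) large))
  generated-complete-coeff≈0 {F} (gcomp {A} {B} {x} {y} gx gy) large = by-arity (size A) (pred B) refl refl
    where
    size+pred≡size : pred B ≡ 0 → size A ℕ.+ pred B ≡ size A
    size+pred≡size B₀ = trans (cong (size A ℕ.+_) B₀) (ℕ.+-identityʳ (size A))
    by-arity : ∀ m n → size A ≡ m → pred B ≡ n → coeffᶜ (A ⊎⁺ B) true (compose A B x y) ≈ 0#
    by-arity zero    _       A₀ _  = R.trans (coeffᶜ-compose-unaryˡ A B A₀ true x y)
      (R.trans (R.*-congˡ (generated-complete-coeff≈0 gy (subst (λ k → aritySum F ℕ.< k ℕ.+ pred B) A₀ large))) (R.zeroʳ _))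
    by-arity (suc _) zero    _  B₀ = R.trans (coeffᶜ-compose-unaryʳ A B B₀ true x y)
      (R.trans (R.*-congʳ (generated-complete-coeff≈0 gx (subst (aritySum F ℕ.<_) (size+pred≡size B₀) large))) (R.zeroˡ _))
    by-arity (suc _) (suc _) A₊ B₊ = coeffᶜ-compose-complete A B A₊ B₊ x y
  generated-complete-coeff≈0 {A = A} (gresp gx x≈y) large =
    R.trans (R.sym (x≈y (constGraph A true))) (generated-complete-coeff≈0 gx large)

  KG-not-finitely-generated : ∀ F → ¬ Generates K (KG K) F
  KG-not-finitely-generated F generates =
    1≉0 (R.trans (R.sym complete≈1) (generated-complete-coeff≈0 (generates V complete) ℕ.≤-refl))
    where
    V : FinSet⁺
    V = record { Carrier⁺ = Fin (2 ℕ.+ aritySum F) ; pred = suc (aritySum F) ; enc⁺ = ↔-refl }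
    complete : LinComb K V
    complete = [ (1# , constGraph V true) ]
    complete≈1 : coeffᶜ V true complete ≈ 1#
    complete≈1 rewrite sameGraph-complete V (constGraph V true) (constGraph V true) (λ _ _ → refl) = R.+-identityʳ 1#

  -- Morphisms out of a free operad

  spMor-∘ : ∀ {H S T} → IsSpecies K T → SpMor K S T → SpMor K H S → SpMor K H T
  spMor-∘ {T = T} T-isSpecies g f = record
    { map      = λ {A} → SpMor.map g {A} ∘ SpMor.map f {A}
    ; map-cong = λ {A} → SpMor.map-cong g {A} ∘ SpMor.map-cong f {A}
    ; map-+    = λ {A} x y → ≈-trans A (SpMor.map-cong g (SpMor.map-+ f x y)) (SpMor.map-+ g _ _)
    ; map-·    = λ {A} c x → ≈-trans A (SpMor.map-cong g (SpMor.map-· f c x)) (SpMor.map-· g c _)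
    ; map-nat  = λ {A} {B} σ x → ≈-trans B (SpMor.map-cong g (SpMor.map-nat f σ x)) (SpMor.map-nat g σ _)
    }
    where
    ≈-trans : ∀ A {x y z : RawSpecies.El T A} → RawSpecies._≈_ T x y → RawSpecies._≈_ T y z → RawSpecies._≈_ T x z
    ≈-trans A = IsModule.≈ᴹ-trans (IsSpecies.isModule T-isSpecies A)

  opMor-∘ : ∀ {P Q S} → IsSpecies K (RawOperad.species S) → OpMor K Q S → OpMor K P Q → OpMor K P S
  opMor-∘ {S = S} S-isSpecies g f = record
    { spMor    = spMor-∘ S-isSpecies (OpMor.spMor g) (OpMor.spMor f)
    ; map-unit = ≈-trans _ (SpMor.map-cong (OpMor.spMor g) (OpMor.map-unit f)) (OpMor.map-unit g)
    ; map-∘    = λ x y → ≈-trans _ (SpMor.map-cong (OpMor.spMor g) (OpMor.map-∘ f x y)) (OpMor.map-∘ g _ _)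
    }
    where
    open RawSpecies (RawOperad.species S) using (El) renaming (_≈_ to _≈ˢ_)
    ≈-trans : ∀ A {x y z : El A} → x ≈ˢ y → y ≈ˢ z → x ≈ˢ z
    ≈-trans A = IsModule.≈ᴹ-trans (IsSpecies.isModule S-isSpecies A)

  opMors-from-free-agree : ∀ {P} (free : IsFree K P) (Q : Operad K) (F G : OpMor K P (Operad.raw Q)) →
    let open RawSpecies (RawOperad.species (Operad.raw Q)) using () renaming (_≈_ to _≈Q_)
        ι = proj₁ (proj₂ free)
    in (∀ {A} h → SpMor.map (OpMor.spMor F) {A} (SpMor.map ι h) ≈Q SpMor.map (OpMor.spMor G) (SpMor.map ι h)) →
       ∀ {A} x → SpMor.map (OpMor.spMor F) {A} x ≈Q SpMor.map (OpMor.spMor G) x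
  opMors-from-free-agree {P} (H , ι , universal) Q F G F≈G {A} x =
    Qₛ.≈ᴹ-trans A (unique F (λ {B} _ → Qₛ.≈ᴹ-refl B) x) (Qₛ.≈ᴹ-sym A (unique G (λ {B} h → Qₛ.≈ᴹ-sym B (F≈G h)) x))
    where
    open RawSpecies (RawOperad.species (Operad.raw Q)) using () renaming (_≈_ to _≈Q_)
    Q-isSpecies : IsSpecies K (RawOperad.species (Operad.raw Q))
    Q-isSpecies = IsOperad.isSpecies (Operad.isOperad Q)
    module Qₛ B = IsModule (IsSpecies.isModule Q-isSpecies B)
    Fι : SpMor K (Species.raw H) (RawOperad.species (Operad.raw Q))
    Fι = spMor-∘ Q-isSpecies (OpMor.spMor F) ι
    E : OpMor K P (Operad.raw Q)
    E = proj₁ (universal Q Fι)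
    unique : ∀ G → (∀ {B} h → SpMor.map (OpMor.spMor G) {B} (SpMor.map ι h) ≈Q SpMor.map Fι h) →
             ∀ {B} y → SpMor.map (OpMor.spMor G) {B} y ≈Q SpMor.map (OpMor.spMor E) y
    unique = proj₂ (proj₂ (universal Q Fι))

  -- The commutative operad over 𝕂[ε]/(ε³)

  -- 𝕂[ε]/(ε³), with (a₀ , a₁ , a₂) standing for a₀ + a₁ε + a₂ε².
  𝔸 : Set
  𝔸 = 𝕂 × 𝕂 × 𝕂

  𝔸-module : LeftModule R.ring 0ℓ 0ℓ
  𝔸-module = DirectProduct.leftModule TensorUnit.leftModule (DirectProduct.leftModule TensorUnit.leftModule TensorUnit.leftModule)

  module M = LeftModule 𝔸-module
  open M using (_≈ᴹ_; _+ᴹ_; _*ₗ_; 0ᴹ)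

  truncatedProduct : {T : Set} → (T → T → T) → (T → T → T) → T × T × T → T × T × T → T × T × T
  truncatedProduct _⊕_ _⊗_ (a₀ , a₁ , a₂) (b₀ , b₁ , b₂) =
    a₀ ⊗ b₀ , (a₀ ⊗ b₁) ⊕ (a₁ ⊗ b₀) , ((a₀ ⊗ b₂) ⊕ (a₁ ⊗ b₁)) ⊕ (a₂ ⊗ b₀)

  infixl 7 _⋆_
  _⋆_ : 𝔸 → 𝔸 → 𝔸
  _⋆_ = truncatedProduct _+_ _*_

  π₀ π₁ π₂ : {T : Set} → T × T × T → T
  π₀ = proj₁
  π₁ = proj₁ ∘ proj₂
  π₂ = proj₂ ∘ proj₂

  Poly³ : ℕ → Set
  Poly³ n = Polynomial n × Polynomial n × Polynomial n

  infixl 6 _+ₚ_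
  infixl 7 _⋆ₚ_
  _+ₚ_ _⋆ₚ_ : ∀ {n} → Poly³ n → Poly³ n → Poly³ n
  (a₀ , a₁ , a₂) +ₚ (b₀ , b₁ , b₂) = a₀ :+ b₀ , a₁ :+ b₁ , a₂ :+ b₂
  _⋆ₚ_ = truncatedProduct _:+_ _:*_

  _·ₚ_ : ∀ {n} → Polynomial n → Poly³ n → Poly³ n
  c ·ₚ (a₀ , a₁ , a₂) = c :* a₀ , c :* a₁ , c :* a₂

  on₂ : ∀ {n} → (Poly³ n → Poly³ n → Polynomial n × Polynomial n) →
        (a₀ a₁ a₂ b₀ b₁ b₂ : Polynomial n) → Polynomial n × Polynomial n
  on₂ f a₀ a₁ a₂ b₀ b₁ b₂ = f (a₀ , a₁ , a₂) (b₀ , b₁ , b₂)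

  on₃ : ∀ {n} → (Poly³ n → Poly³ n → Poly³ n → Polynomial n × Polynomial n) →
        (a₀ a₁ a₂ b₀ b₁ b₂ c₀ c₁ c₂ : Polynomial n) → Polynomial n × Polynomial n
  on₃ f a₀ a₁ a₂ b₀ b₁ b₂ c₀ c₁ c₂ = f (a₀ , a₁ , a₂) (b₀ , b₁ , b₂) (c₀ , c₁ , c₂)

  ⋆-cong : ∀ {x x′ y y′} → x ≈ᴹ x′ → y ≈ᴹ y′ → x ⋆ y ≈ᴹ x′ ⋆ y′
  ⋆-cong (a₀ , a₁ , a₂) (b₀ , b₁ , b₂) =
      R.*-cong a₀ b₀
    , R.+-cong (R.*-cong a₀ b₁) (R.*-cong a₁ b₀)
    , R.+-cong (R.+-cong (R.*-cong a₀ b₂) (R.*-cong a₁ b₁)) (R.*-cong a₂ b₀)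

  ⋆-comm : ∀ x y → x ⋆ y ≈ᴹ y ⋆ x
  ⋆-comm (a₀ , a₁ , a₂) (b₀ , b₁ , b₂) =
      solve 6 (on₂ λ a b → π₀ (a ⋆ₚ b) := π₀ (b ⋆ₚ a)) R.refl a₀ a₁ a₂ b₀ b₁ b₂
    , solve 6 (on₂ λ a b → π₁ (a ⋆ₚ b) := π₁ (b ⋆ₚ a)) R.refl a₀ a₁ a₂ b₀ b₁ b₂
    , solve 6 (on₂ λ a b → π₂ (a ⋆ₚ b) := π₂ (b ⋆ₚ a)) R.refl a₀ a₁ a₂ b₀ b₁ b₂

  ⋆-assoc : ∀ x y z → (x ⋆ y) ⋆ z ≈ᴹ x ⋆ (y ⋆ z)
  ⋆-assoc (a₀ , a₁ , a₂) (b₀ , b₁ , b₂) (c₀ , c₁ , c₂) =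
      solve 9 (on₃ λ a b c → π₀ (a ⋆ₚ b ⋆ₚ c) := π₀ (a ⋆ₚ (b ⋆ₚ c))) R.refl a₀ a₁ a₂ b₀ b₁ b₂ c₀ c₁ c₂
    , solve 9 (on₃ λ a b c → π₁ (a ⋆ₚ b ⋆ₚ c) := π₁ (a ⋆ₚ (b ⋆ₚ c))) R.refl a₀ a₁ a₂ b₀ b₁ b₂ c₀ c₁ c₂
    , solve 9 (on₃ λ a b c → π₂ (a ⋆ₚ b ⋆ₚ c) := π₂ (a ⋆ₚ (b ⋆ₚ c))) R.refl a₀ a₁ a₂ b₀ b₁ b₂ c₀ c₁ c₂

  ⋆-distribʳ : ∀ x x′ y → (x +ᴹ x′) ⋆ y ≈ᴹ x ⋆ y +ᴹ x′ ⋆ y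
  ⋆-distribʳ (a₀ , a₁ , a₂) (a₀′ , a₁′ , a₂′) (b₀ , b₁ , b₂) =
      solve 9 (on₃ λ a a′ b → π₀ ((a +ₚ a′) ⋆ₚ b) := π₀ (a ⋆ₚ b) :+ π₀ (a′ ⋆ₚ b))
              R.refl a₀ a₁ a₂ a₀′ a₁′ a₂′ b₀ b₁ b₂
    , solve 9 (on₃ λ a a′ b → π₁ ((a +ₚ a′) ⋆ₚ b) := π₁ (a ⋆ₚ b) :+ π₁ (a′ ⋆ₚ b))
              R.refl a₀ a₁ a₂ a₀′ a₁′ a₂′ b₀ b₁ b₂
    , solve 9 (on₃ λ a a′ b → π₂ ((a +ₚ a′) ⋆ₚ b) := π₂ (a ⋆ₚ b) :+ π₂ (a′ ⋆ₚ b))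
              R.refl a₀ a₁ a₂ a₀′ a₁′ a₂′ b₀ b₁ b₂

  ⋆-*ₗ-assoc : ∀ c x y → (c *ₗ x) ⋆ y ≈ᴹ c *ₗ (x ⋆ y)
  ⋆-*ₗ-assoc c (a₀ , a₁ , a₂) (b₀ , b₁ , b₂) =
      solve 7 (λ c → on₂ λ a b → π₀ ((c ·ₚ a) ⋆ₚ b) := c :* π₀ (a ⋆ₚ b)) R.refl c a₀ a₁ a₂ b₀ b₁ b₂
    , solve 7 (λ c → on₂ λ a b → π₁ ((c ·ₚ a) ⋆ₚ b) := c :* π₁ (a ⋆ₚ b)) R.refl c a₀ a₁ a₂ b₀ b₁ b₂
    , solve 7 (λ c → on₂ λ a b → π₂ ((c ·ₚ a) ⋆ₚ b) := c :* π₂ (a ⋆ₚ b)) R.refl c a₀ a₁ a₂ b₀ b₁ b₂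

  𝟙 : 𝔸
  𝟙 = 1# , 0# , 0#

  ⋆-identityˡ : ∀ x → 𝟙 ⋆ x ≈ᴹ x
  ⋆-identityˡ (b₀ , b₁ , b₂) =
      solve 3 (λ b₀ b₁ b₂ → π₀ ((con 1 , con 0 , con 0) ⋆ₚ (b₀ , b₁ , b₂)) := b₀) R.refl b₀ b₁ b₂
    , solve 3 (λ b₀ b₁ b₂ → π₁ ((con 1 , con 0 , con 0) ⋆ₚ (b₀ , b₁ , b₂)) := b₁) R.refl b₀ b₁ b₂
    , solve 3 (λ b₀ b₁ b₂ → π₂ ((con 1 , con 0 , con 0) ⋆ₚ (b₀ , b₁ , b₂)) := b₂) R.refl b₀ b₁ b₂

  ⋆-identityʳ : ∀ x → x ⋆ 𝟙 ≈ᴹ x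
  ⋆-identityʳ x = M.≈ᴹ-trans (⋆-comm x 𝟙) (⋆-identityˡ x)

  ⋆-distribˡ : ∀ x y y′ → x ⋆ (y +ᴹ y′) ≈ᴹ x ⋆ y +ᴹ x ⋆ y′
  ⋆-distribˡ x y y′ = M.≈ᴹ-trans (⋆-comm x _) (M.≈ᴹ-trans (⋆-distribʳ y y′ x) (M.+ᴹ-cong (⋆-comm y x) (⋆-comm y′ x)))

  ⋆-*ₗ-comm : ∀ c x y → x ⋆ (c *ₗ y) ≈ᴹ c *ₗ (x ⋆ y)
  ⋆-*ₗ-comm c x y = M.≈ᴹ-trans (⋆-comm x _) (M.≈ᴹ-trans (⋆-*ₗ-assoc c y x) (M.*ₗ-congˡ (⋆-comm y x)))

  ⋆-*ₗ : ∀ a b x y → (a *ₗ x) ⋆ (b *ₗ y) ≈ᴹ (a * b) *ₗ (x ⋆ y)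
  ⋆-*ₗ a b x y = M.≈ᴹ-trans (⋆-*ₗ-assoc a x _) (M.≈ᴹ-trans (M.*ₗ-congˡ (⋆-*ₗ-comm b x y)) (M.≈ᴹ-sym (M.*ₗ-assoc a b _)))

  ⋆-exchange : ∀ x y z → (x ⋆ y) ⋆ z ≈ᴹ (x ⋆ z) ⋆ y
  ⋆-exchange x y z = M.≈ᴹ-trans (⋆-assoc x y z) (M.≈ᴹ-trans (⋆-cong M.≈ᴹ-refl (⋆-comm y z)) (M.≈ᴹ-sym (⋆-assoc x z y)))

  𝔸-species : RawSpecies K
  𝔸-species = record
    { El = λ _ → 𝔸 ; _≈_ = _≈ᴹ_ ; _+_ = _+ᴹ_ ; 0v = 0ᴹ ; -_ = M.-ᴹ_ ; _·_ = _*ₗ_ ; relabel = λ _ x → x }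

  𝔸-rawOperad : RawOperad K
  𝔸-rawOperad = record { species = 𝔸-species ; unit = 𝟙 ; _∘ₒ_ = _⋆_ }

  𝔸-isSpecies : IsSpecies K 𝔸-species
  𝔸-isSpecies = record
    { isModule     = λ _ → IsModuleFromLeft.isModule (record { isLeftModule = M.isLeftModule })
    ; relabel-cong = λ _ x≈y → x≈y
    ; relabel-+    = λ _ _ _ → M.≈ᴹ-refl
    ; relabel-·    = λ _ _ _ → M.≈ᴹ-refl
    ; relabel-id   = λ _ → M.≈ᴹ-refl
    ; relabel-∘    = λ _ _ _ → M.≈ᴹ-refl
    ; relabel-ext  = λ _ _ _ _ → M.≈ᴹ-refl
    }

  𝔸-operad : Operad K
  𝔸-operad = record
    { raw      = 𝔸-rawOperad
    ; isOperad = record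
      { isSpecies = 𝔸-isSpecies
      ; ∘-cong    = ⋆-cong
      ; ∘-+ˡ      = ⋆-distribʳ
      ; ∘-+ʳ      = ⋆-distribˡ
      ; ∘-·ˡ      = ⋆-*ₗ-assoc
      ; ∘-·ʳ      = ⋆-*ₗ-comm
      ; ∘-equiv   = λ _ _ _ _ → M.≈ᴹ-refl
      ; unitˡ     = ⋆-identityˡ
      ; unitʳ     = ⋆-identityʳ
      ; ∘-seq     = ⋆-assoc
      ; ∘-par     = ⋆-exchange
      }
    }

  -- θ is the algebra endomorphism ε ↦ ε² of 𝕂[ε]/(ε³); swap, exchanging the coordinates of ε and ε²,
  -- is merely linear.
  θ swap : 𝔸 → 𝔸
  θ    (a₀ , a₁ , a₂) = a₀ , 0# , a₁
  swap (a₀ , a₁ , a₂) = a₀ , a₂ , a₁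

  θ-cong : ∀ {x y} → x ≈ᴹ y → θ x ≈ᴹ θ y
  θ-cong (a₀ , a₁ , _) = a₀ , R.refl , a₁

  θ-⋆ : ∀ x y → θ (x ⋆ y) ≈ᴹ θ x ⋆ θ y
  θ-⋆ (a₀ , a₁ , a₂) (b₀ , b₁ , b₂) =
      R.refl
    , solve 2 (λ a₀ b₀ → con 0 := a₀ :* con 0 :+ con 0 :* b₀) R.refl a₀ b₀
    , solve 4 (λ a₀ a₁ b₀ b₁ → a₀ :* b₁ :+ a₁ :* b₀ := a₀ :* b₁ :+ con 0 :* con 0 :+ a₁ :* b₀) R.refl a₀ a₁ b₀ b₁

  θ-opMor : OpMor K 𝔸-rawOperad 𝔸-rawOperad
  θ-opMor = record
    { spMor    = record
      { map      = θ
      ; map-cong = θ-cong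
      ; map-+    = λ _ _ → R.refl , R.sym (R.+-identityʳ 0#) , R.refl
      ; map-·    = λ c _ → R.refl , R.sym (R.zeroʳ c) , R.refl
      ; map-nat  = λ _ _ → M.≈ᴹ-refl
      }
    ; map-unit = M.≈ᴹ-refl
    ; map-∘    = θ-⋆
    }

  swap-spMor : SpMor K 𝔸-species 𝔸-species
  swap-spMor = record
    { map      = swap
    ; map-cong = λ { (a₀ , a₁ , a₂) → a₀ , a₂ , a₁ }
    ; map-+    = λ _ _ → M.≈ᴹ-refl
    ; map-·    = λ _ _ → M.≈ᴹ-refl
    ; map-nat  = λ _ _ → M.≈ᴹ-refl
    }

  θ∘swap-fixes : ∀ x → π₁ x ≈ 0# → θ (swap x) ≈ᴹ x
  θ∘swap-fixes _ a₁≈0 = R.refl , R.sym a₁≈0 , R.refl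

  HasLeadingε : 𝔸 → Set
  HasLeadingε a = π₀ a ≈ 0# × π₁ a ≈ 1#

  ε⋆ε : ∀ {a b} → HasLeadingε a → HasLeadingε b → π₂ (a ⋆ b) ≈ 1#
  ε⋆ε {_ , _ , a₂} {_ , _ , b₂} (a₀≈0 , a₁≈1) (b₀≈0 , b₁≈1) =
    R.trans (R.+-cong (R.+-cong (R.*-cong a₀≈0 R.refl) (R.*-cong a₁≈1 b₁≈1)) (R.*-cong R.refl b₀≈0))
            (solve 2 (λ a₂ b₂ → con 0 :* b₂ :+ con 1 :* con 1 :+ a₂ :* con 0 := con 1) R.refl a₂ b₂)

  -- An operad morphism 𝕂𝐆 → 𝕂[ε]/(ε³)

  ε²^_ : ℕ → 𝔸
  ε²^ 0             = 𝟙
  ε²^ 1             = 0# , 0# , 1#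
  ε²^ (suc (suc _)) = 0ᴹ

  ε²-annihilates : ∀ s t → (0# , 0# , s) ⋆ (0# , 0# , t) ≈ᴹ 0ᴹ
  ε²-annihilates s t =
      R.zeroˡ 0#
    , solve 0 (con 0 :* con 0 :+ con 0 :* con 0 := con 0) R.refl
    , solve 2 (λ s t → con 0 :* t :+ con 0 :* con 0 :+ s :* con 0 := con 0) R.refl s t

  ε²^-+ : ∀ m n → ε²^ m ⋆ ε²^ n ≈ᴹ ε²^ (m ℕ.+ n)
  ε²^-+ 0                 n                 = ⋆-identityˡ (ε²^ n)
  ε²^-+ 1                 0                 = ⋆-identityʳ (ε²^ 1)
  ε²^-+ 1                 1                 = ε²-annihilates 1# 1#
  ε²^-+ 1                 (suc (suc _))     = ε²-annihilates 1# 0#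
  ε²^-+ (suc (suc _))     0                 = ⋆-identityʳ 0ᴹ
  ε²^-+ (suc (suc _))     1                 = ε²-annihilates 0# 1#
  ε²^-+ (suc (suc _))     (suc (suc _))     = ε²-annihilates 0# 0#

  ε²^-vanishes : ∀ m n → ε²^ (suc m ℕ.+ suc n) ≡ 0ᴹ
  ε²^-vanishes zero    n = refl
  ε²^-vanishes (suc m) n = refl

  *ₗ-ε²^-+ : ∀ m n {a b} → (m ≡ 0 ⊎ n ≡ 0 → a ≈ b) → a *ₗ ε²^ (m ℕ.+ n) ≈ᴹ b *ₗ ε²^ (m ℕ.+ n)
  *ₗ-ε²^-+ zero    n       a≈b = M.*ₗ-congʳ (a≈b (inj₁ refl))
  *ₗ-ε²^-+ (suc m) zero    a≈b = M.*ₗ-congʳ (a≈b (inj₂ refl))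
  *ₗ-ε²^-+ (suc m) (suc n) {a} {b} _ rewrite ε²^-vanishes m n = M.≈ᴹ-trans (M.*ₗ-zeroʳ a) (M.≈ᴹ-sym (M.*ₗ-zeroʳ b))

  *ₗ-ε²^-has-no-ε : ∀ t n → π₁ (t *ₗ ε²^ n) ≈ 0#
  *ₗ-ε²^-has-no-ε t 0             = R.zeroʳ t
  *ₗ-ε²^-has-no-ε t 1             = R.zeroʳ t
  *ₗ-ε²^-has-no-ε t (suc (suc _)) = R.zeroʳ t

  -- On one vertex every graph is empty and on two every graph is empty or complete, so for V of
  -- arity n ≤ 1, total n (coeffᶜ V false x) (coeffᶜ V true x) is the sum of all coefficients of x.
  -- Higher arities do not matter, since ε²^ n vanishes there.
  total : ℕ → 𝕂 → 𝕂 → 𝕂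
  total zero    e k = e
  total (suc _) e k = e + k

  total-cong : ∀ n {e e′ k k′} → e ≈ e′ → k ≈ k′ → total n e k ≈ total n e′ k′
  total-cong zero    e≈e′ _    = e≈e′
  total-cong (suc _) e≈e′ k≈k′ = R.+-cong e≈e′ k≈k′

  total-+ : ∀ n {e k e₁ k₁ e₂ k₂} → e ≈ e₁ + e₂ → k ≈ k₁ + k₂ → total n e k ≈ total n e₁ k₁ + total n e₂ k₂
  total-+ zero    e≈ _ = e≈
  total-+ (suc _) {e₁ = e₁} {k₁} {e₂} {k₂} e≈ k≈ = R.trans (R.+-cong e≈ k≈)
    (solve 4 (λ e₁ k₁ e₂ k₂ → (e₁ :+ e₂) :+ (k₁ :+ k₂) := (e₁ :+ k₁) :+ (e₂ :+ k₂)) R.refl e₁ k₁ e₂ k₂)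

  total-*ˡ : ∀ n {c e k e′ k′} → e ≈ c * e′ → k ≈ c * k′ → total n e k ≈ c * total n e′ k′
  total-*ˡ zero    e≈ _  = e≈
  total-*ˡ (suc _) e≈ k≈ = R.trans (R.+-cong e≈ k≈) (R.sym (R.distribˡ _ _ _))

  total-*ʳ : ∀ n {c e k e′ k′} → e ≈ e′ * c → k ≈ k′ * c → total n e k ≈ total n e′ k′ * c
  total-*ʳ zero    e≈ _  = e≈
  total-*ʳ (suc _) e≈ k≈ = R.trans (R.+-cong e≈ k≈) (R.sym (R.distribʳ _ _ _))

  totalᶜ : ∀ V → LinComb K V → 𝕂
  totalᶜ V x = total (pred V) (coeffᶜ V false x) (coeffᶜ V true x)

  totalᶜ-compose : ∀ A B → size A ≡ 0 ⊎ pred B ≡ 0 → ∀ x y →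
                   totalᶜ (A ⊎⁺ B) (compose A B x y) ≈ totalᶜ (Maybe⁺ A) x * totalᶜ B y
  totalᶜ-compose A B (inj₁ A₀) x y = begin
    total (size A ℕ.+ pred B) e k       ≡⟨ cong (λ m → total (m ℕ.+ pred B) e k) A₀ ⟩
    total (pred B) e k
      ≈⟨ total-*ˡ (pred B) (coeffᶜ-compose-unaryˡ A B A₀ false x y) (coeffᶜ-compose-unaryˡ A B A₀ true x y) ⟩
    coeffᶜ (Maybe⁺ A) false x * totalᶜ B y
      ≡⟨ cong (λ m → total m (coeffᶜ (Maybe⁺ A) false x) (coeffᶜ (Maybe⁺ A) true x) * totalᶜ B y) A₀ ⟨
    totalᶜ (Maybe⁺ A) x * totalᶜ B y    ∎
    where
    open SetoidReasoning R.setoid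
    e k : 𝕂
    e = coeffᶜ (A ⊎⁺ B) false (compose A B x y)
    k = coeffᶜ (A ⊎⁺ B) true (compose A B x y)
  totalᶜ-compose A B (inj₂ B₀) x y = begin
    total (size A ℕ.+ pred B) e k       ≡⟨ cong (λ n → total n e k) (trans (cong (size A ℕ.+_) B₀) (ℕ.+-identityʳ (size A))) ⟩
    total (size A) e k
      ≈⟨ total-*ʳ (size A) (coeffᶜ-compose-unaryʳ A B B₀ false x y) (coeffᶜ-compose-unaryʳ A B B₀ true x y) ⟩
    totalᶜ (Maybe⁺ A) x * coeffᶜ B false y
      ≡⟨ cong (λ n → totalᶜ (Maybe⁺ A) x * total n (coeffᶜ B false y) (coeffᶜ B true y)) B₀ ⟨
    totalᶜ (Maybe⁺ A) x * totalᶜ B y    ∎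
    where
    open SetoidReasoning R.setoid
    e k : 𝕂
    e = coeffᶜ (A ⊎⁺ B) false (compose A B x y)
    k = coeffᶜ (A ⊎⁺ B) true (compose A B x y)

  Ψ : ∀ V → LinComb K V → 𝔸
  Ψ V x = totalᶜ V x *ₗ ε²^ pred V

  Ψ-relabel : ∀ V W (σ : Carrier⁺ V ↔ Carrier⁺ W) x → Ψ W (relabel V W σ x) ≡ Ψ V x
  Ψ-relabel V W σ x = trans
    (cong₂ (λ e k → total (pred W) e k *ₗ ε²^ pred W) (coeffᶜ-relabel V W σ false x) (coeffᶜ-relabel V W σ true x))
    (cong (λ n → total n (coeffᶜ V false x) (coeffᶜ V true x) *ₗ ε²^ n) (sym (↔⇒pred≡ V W σ)))

  Ψ-compose : ∀ A B x y → Ψ (A ⊎⁺ B) (compose A B x y) ≈ᴹ Ψ (Maybe⁺ A) x ⋆ Ψ B y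
  Ψ-compose A B x y = begin
    totalᶜ (A ⊎⁺ B) (compose A B x y) *ₗ ε²^ (size A ℕ.+ pred B)
      ≈⟨ *ₗ-ε²^-+ (size A) (pred B) (λ unary → totalᶜ-compose A B unary x y) ⟩
    (totalᶜ (Maybe⁺ A) x * totalᶜ B y) *ₗ ε²^ (size A ℕ.+ pred B)
      ≈⟨ M.*ₗ-congˡ (ε²^-+ (size A) (pred B)) ⟨
    (totalᶜ (Maybe⁺ A) x * totalᶜ B y) *ₗ (ε²^ size A ⋆ ε²^ pred B)
      ≈⟨ ⋆-*ₗ _ _ _ _ ⟨
    Ψ (Maybe⁺ A) x ⋆ Ψ B y ∎
    where open SetoidReasoning M.≈ᴹ-setoid

  Ψ-opMor : OpMor K (KG K) 𝔸-rawOperad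
  Ψ-opMor = record
    { spMor    = record
      { map      = λ {V} → Ψ V
      ; map-cong = λ {V} x≈y → M.*ₗ-congʳ (total-cong (pred V) (x≈y (constGraph V false)) (x≈y (constGraph V true)))
      ; map-+    = λ {V} x y → M.≈ᴹ-trans (M.*ₗ-congʳ (total-+ (pred V) (weight-++ _ x y) (weight-++ _ x y))) (M.*ₗ-distribʳ _ _ _)
      ; map-·    = λ {V} c x → M.≈ᴹ-trans (M.*ₗ-congʳ (total-*ˡ (pred V) (weight-scale _ c x) (weight-scale _ c x))) (M.*ₗ-assoc c _ _)
      ; map-nat  = λ {V} {W} σ x → M.≈ᴹ-reflexive (Ψ-relabel V W σ x)
      }
    ; map-unit = M.≈ᴹ-trans (M.*ₗ-congʳ (R.+-identityʳ 1#)) (M.*ₗ-identityˡ 𝟙)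
    ; map-∘    = λ {A} {B} → Ψ-compose A B
    }

  -- 𝕂𝐆 is not free

  point : FinSet
  point = record { Carrier = ⊤ ; size = 1 ; enc = ↔-sym 1↔⊤ }

  V₂ V₃ : FinSet⁺
  V₂ = Maybe⁺ point
  V₃ = point ⊎⁺ V₂

  edge₂ noEdge₂ : LinComb K V₂
  edge₂   = [ (1# , constGraph V₂ true) ]
  noEdge₂ = [ (1# , constGraph V₂ false) ]

  transpose₁ transpose₂ : Carrier⁺ V₃ → Carrier⁺ V₃
  transpose₁ (inj₁ tt)          = inj₂ (just tt)
  transpose₁ (inj₂ nothing)     = inj₂ nothing
  transpose₁ (inj₂ (just tt))   = inj₁ tt
  transpose₂ (inj₁ tt)          = inj₂ nothing
  transpose₂ (inj₂ nothing)     = inj₁ tt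
  transpose₂ (inj₂ (just tt))   = inj₂ (just tt)

  transpose₁-involutive : ∀ v → transpose₁ (transpose₁ v) ≡ v
  transpose₁-involutive (inj₁ tt)        = refl
  transpose₁-involutive (inj₂ nothing)   = refl
  transpose₁-involutive (inj₂ (just tt)) = refl

  transpose₂-involutive : ∀ v → transpose₂ (transpose₂ v) ≡ v
  transpose₂-involutive (inj₁ tt)        = refl
  transpose₂-involutive (inj₂ nothing)   = refl
  transpose₂-involutive (inj₂ (just tt)) = refl

  τ₁ τ₂ : Carrier⁺ V₃ ↔ Carrier⁺ V₃
  τ₁ = mk↔ₛ′ transpose₁ transpose₁ transpose₁-involutive transpose₁-involutive
  τ₂ = mk↔ₛ′ transpose₂ transpose₂ transpose₂-involutive transpose₂-involutive

  edge∘noEdge noEdge∘edge : LinComb K V₃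
  edge∘noEdge = compose point V₂ edge₂ noEdge₂
  noEdge∘edge = compose point V₂ noEdge₂ edge₂

  -- Grafting the edge into the empty graph on two vertices joins the new vertex to either of them;
  -- the two results are the images of noEdge∘edge under two transpositions. Both sides normalise
  -- to the same term.
  grafting-relation : ∀ g → coeff K V₃ edge∘noEdge g ≈
                            coeff K V₃ (relabel V₃ V₃ τ₁ noEdge∘edge ++ relabel V₃ V₃ τ₂ noEdge∘edge) g
  grafting-relation g = R.refl

  KG-not-free : ¬ IsFree K (KG K)
  KG-not-free free@(H , ι , universal) = 1≉0 (identityˡ-unique 1# 1# (R.sym 1≈1+1))
    where
    open GroupProperties R.+-group using (identityˡ-unique)
    swapΨι : SpMor K (Species.raw H) 𝔸-species
    swapΨι = spMor-∘ 𝔸-isSpecies swap-spMor (spMor-∘ 𝔸-isSpecies (OpMor.spMor Ψ-opMor) ι)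
    Φ : OpMor K (KG K) 𝔸-rawOperad
    Φ = proj₁ (universal 𝔸-operad swapΨι)
    module Φ = SpMor (OpMor.spMor Φ)
    Φ-on-ι : ∀ {A} h → Φ.map (SpMor.map ι h) ≈ᴹ swap (Ψ A (SpMor.map ι h))
    Φ-on-ι = proj₁ (proj₂ (universal 𝔸-operad swapΨι))
    θΦ≈Ψ : ∀ V x → θ (Φ.map {V} x) ≈ᴹ Ψ V x
    θΦ≈Ψ V = opMors-from-free-agree free 𝔸-operad (opMor-∘ 𝔸-isSpecies θ-opMor Φ) Ψ-opMor
      (λ {A} h → M.≈ᴹ-trans (θ-cong (Φ-on-ι {A} h)) (θ∘swap-fixes _ (*ₗ-ε²^-has-no-ε _ (pred A))))
    Φ-leading-ε : ∀ x → totalᶜ V₂ x ≈ 1# → HasLeadingε (Φ.map x)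
    Φ-leading-ε x total≈1 =
      R.trans (proj₁ (θΦ≈Ψ V₂ x)) (R.zeroʳ _) , R.trans (proj₂ (proj₂ (θΦ≈Ψ V₂ x))) (R.trans (R.*-identityʳ _) total≈1)
    Φ-edge₂ : HasLeadingε (Φ.map edge₂)
    Φ-edge₂ = Φ-leading-ε edge₂ (R.trans (R.+-identityˡ _) (R.+-identityʳ 1#))
    Φ-noEdge₂ : HasLeadingε (Φ.map noEdge₂)
    Φ-noEdge₂ = Φ-leading-ε noEdge₂ (R.trans (R.+-identityʳ _) (R.+-identityʳ 1#))
    edge∘noEdge-ε²≈1 : π₂ (Φ.map edge∘noEdge) ≈ 1#
    edge∘noEdge-ε²≈1 = R.trans (proj₂ (proj₂ (OpMor.map-∘ Φ {point} {V₂} edge₂ noEdge₂))) (ε⋆ε Φ-edge₂ Φ-noEdge₂)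
    noEdge∘edge-ε²≈1 : π₂ (Φ.map noEdge∘edge) ≈ 1#
    noEdge∘edge-ε²≈1 = R.trans (proj₂ (proj₂ (OpMor.map-∘ Φ {point} {V₂} noEdge₂ edge₂))) (ε⋆ε Φ-noEdge₂ Φ-edge₂)
    Φ-grafting-relation : Φ.map edge∘noEdge ≈ᴹ Φ.map noEdge∘edge +ᴹ Φ.map noEdge∘edge
    Φ-grafting-relation = M.≈ᴹ-trans (Φ.map-cong {V₃} grafting-relation)
      (M.≈ᴹ-trans (Φ.map-+ {V₃} _ _)
                  (M.+ᴹ-cong (Φ.map-nat {V₃} {V₃} τ₁ noEdge∘edge) (Φ.map-nat {V₃} {V₃} τ₂ noEdge∘edge)))
    1≈1+1 : 1# ≈ 1# + 1#
    1≈1+1 = R.trans (R.sym edge∘noEdge-ε²≈1)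
                    (R.trans (proj₂ (proj₂ Φ-grafting-relation)) (R.+-cong noEdge∘edge-ε²≈1 noEdge∘edge-ε²≈1))

mainTheorem3 : (K : CharZeroField) →
    ¬ IsFree K (KG K) × (∀ (F : Family K (KG K)) → ¬ Generates K (KG K) F)
mainTheorem3 K = KG-not-free K , KG-not-finitely-generated K
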